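{- Let $G$ be a connected $4K_1$-free graph. Then $G$ has a Hamiltonian path if and only if (a) for every articulation point $x$ of $G$, the graph $G-\{x\}$ has exactly 2 connected components, and (b) there are no 3 articulation points of $G$ inducing a triangle in $G$. Moreover, if $G$ does not have a Hamiltonian path, then $G$ has a path cover of size 2 (i.e., its vertex set can be covered by two vertex-disjoint paths).
   Context: Graphs are finite, simple and undirected. A graph is $4K_1$-free if it contains no four pairwise non-adjacent vertices (independence number at most 3). A Hamiltonian path is a path containing all vertices of the graph. An articulation point of $G$ is a vertex $x$ such that $G-\{x\}$ is disconnected. -}

module Defs where

open import Data.Nat using (ℕ; _≥_)
open import Data.Fin using (Fin)
open import Data.Bool using (Bool; true; false)
open import Data.List using (List; []; _∷_; length)
open import Data.List.Membership.Propositional using (_∈_)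
open import Data.List.Relation.Unary.Unique.Propositional using (Unique)
open import Data.Product using (Σ; ∃; ∃-syntax; _×_; _,_)
open import Data.Sum using (_⊎_)
open import Data.Unit using (⊤)
open import Relation.Nullary using (¬_)
open import Relation.Binary.PropositionalEquality using (_≡_; _≢_)

record Graph : Set where
  field
    n      : ℕ
    adj    : Fin n → Fin n → Bool
    sym    : ∀ u v → adj u v ≡ adj v u
    irrefl : ∀ u → adj u u ≡ false

open Graph public

Adj : (G : Graph) → Fin (n G) → Fin (n G) → Set
Adj G u v = adj G u v ≡ true

data WalkIn (G : Graph) (S : Fin (n G) → Set) : Fin (n G) → Fin (n G) → Set where
  here : ∀ {u} → S u → WalkIn G S u u
  step : ∀ {u w v} → S u → Adj G u w → WalkIn G S w v → WalkIn G S u v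

Connected : Graph → Set
Connected G = (n G ≥ 1) × (∀ u v → WalkIn G (λ _ → ⊤) u v)

Minus : (G : Graph) → Fin (n G) → Fin (n G) → Set
Minus G x v = v ≢ x

Articulation : (G : Graph) → Fin (n G) → Set
Articulation G x =
  ∃[ u ] ∃[ v ] (u ≢ x × v ≢ x × ¬ WalkIn G (Minus G x) u v)

-- G - {x} has exactly two connected components: two vertices in different
-- components, and every vertex lies in the component of one of them.
TwoComponents : (G : Graph) → Fin (n G) → Set
TwoComponents G x =
  ∃[ u ] ∃[ v ] (u ≢ x × v ≢ x × ¬ WalkIn G (Minus G x) u v ×
    (∀ w → w ≢ x → WalkIn G (Minus G x) u w ⊎ WalkIn G (Minus G x) v w))

FourK1Free : Graph → Set
FourK1Free G = ¬ (∃[ a ] ∃[ b ] ∃[ c ] ∃[ d ]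
  (a ≢ b × a ≢ c × a ≢ d × b ≢ c × b ≢ d × c ≢ d ×
   ¬ Adj G a b × ¬ Adj G a c × ¬ Adj G a d ×
   ¬ Adj G b c × ¬ Adj G b d × ¬ Adj G c d))

data Chain (G : Graph) : List (Fin (n G)) → Set where
  []  : Chain G []
  [-] : ∀ {u} → Chain G (u ∷ [])
  _∷_ : ∀ {u v vs} → Adj G u v → Chain G (v ∷ vs) → Chain G (u ∷ v ∷ vs)

IsPath : (G : Graph) → List (Fin (n G)) → Set
IsPath G p = (length p ≥ 1) × Unique p × Chain G p

HamiltonianPath : Graph → Set
HamiltonianPath G = Σ (List (Fin (n G))) λ p → IsPath G p × (∀ v → v ∈ p)

PathCover2 : Graph → Set
PathCover2 G = Σ (List (Fin (n G))) λ p → Σ (List (Fin (n G))) λ q →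
  IsPath G p × IsPath G q × (∀ v → v ∈ p → ¬ v ∈ q) × (∀ v → v ∈ p ⊎ v ∈ q)

CondA : Graph → Set
CondA G = ∀ x → Articulation G x → TwoComponents G x

CondB : Graph → Set
CondB G = ¬ (∃[ x ] ∃[ y ] ∃[ z ]
  (Articulation G x × Articulation G y × Articulation G z ×
   Adj G x y × Adj G y z × Adj G x z))

module Submission where

-- Along a Hamiltonian path, deleting a vertex m leaves the subpaths before and after m, which are
-- connected and cover G - m.  Hence an articulation point leaves exactly two components, and in a
-- triangle the middle vertex in path order has its two other vertices on opposite sides and adjacent,
-- so it is not an articulation point.
--
-- Conversely take a longest path P = p₁ … pₖ that misses a vertex; by connectivity some r₀ off P is
-- adjacent to an interior vertex c of P.  Maximality of P together with 4K₁-freeness (applied to p₁,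
-- pₖ and vertices off P) shows p₁ ≁ pₖ, that the vertices off P form a clique attached to P only at
-- c, so that P and this clique form a path cover of size 2, and that c is an articulation point.  If
-- no edge joins the sides L = p₁ … ℓ and R = ρ … pₖ of c, then G - c has three components;
-- otherwise the only such edge is ℓρ, and ℓ, c, ρ are articulation points forming a triangle.

open import Defs renaming (sym to adj-sym)
open import Data.Bool using (true)
import Data.Bool.Properties as Bool
open import Data.Empty using (⊥; ⊥-elim)
open import Data.Fin using (Fin; fromℕ<) renaming (_≟_ to _≟ᶠ_)
import Data.Fin.Properties as Fin
open import Data.List using (List; []; _∷_; _++_; [_]; reverse; length; filter; allFin; cartesianProductWith)
import Data.List.Properties as List
open import Data.List.Extrema.Nat using (argmax; argmax-all; f[xs]≤f[argmax])
open import Data.List.Membership.Propositional using (_∈_; _∉_; find; lose)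
open import Data.List.Membership.Propositional.Properties
  using (∈-++⁺ˡ; ∈-++⁺ʳ; ∈-++⁻; ∈-∃++; ∈-allFin; ∈-filter⁺; ∈-filter⁻; ∈-cartesianProductWith⁺)
open import Data.List.Relation.Binary.Permutation.Propositional
  using (_↭_; ↭-refl; ↭-sym; ↭-trans; ↭-prep; ↭-swap; ↭-reflexive; ↭⇒↭ₛ)
open import Data.List.Relation.Binary.Permutation.Propositional.Properties
  using (∈-resp-↭; ↭-length; ↭-reverse; shift; ++⁺; ++⁺ˡ; ++⁺ʳ; ++-comm; ++-commutativeMonoid)
import Data.List.Relation.Binary.Permutation.Setoid.Properties as PermutationSetoid
open import Data.List.Relation.Unary.All as All using (All; []; _∷_)
open import Data.List.Relation.Unary.All.Properties using (¬Any⇒All¬; All¬⇒¬Any; ++⁻ˡ; ++⁻ʳ; all-filter)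
open import Data.List.Relation.Unary.Any as Any using (here; there)
open import Data.List.Relation.Unary.Any.Properties using (reverse⁺; reverse⁻)
open import Data.List.Relation.Unary.Unique.Propositional using (Unique; []; _∷_)
open import Data.List.Relation.Unary.Unique.Propositional.Properties using (Unique[x∷xs]⇒x∉xs; allFin⁺) renaming (filter⁺ to Unique-filter⁺)
open import Data.Nat using (ℕ; zero; suc; _≤_; _≥_; z≤n; s≤s)
import Data.Nat.Properties as ℕ
open import Data.Product using (Σ; ∃-syntax; _×_; _,_; proj₁; proj₂; map₁)
open import Data.Sum as Sum using (_⊎_; inj₁; inj₂)
open import Function.Bundles using (_⇔_; mk⇔)
open import Relation.Binary.PropositionalEquality using (_≡_; _≢_; refl; sym; trans; cong; subst; setoid; module ≡-Reasoning)
open import Relation.Nullary using (¬_; Dec; yes; no; ¬?)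
open import Relation.Nullary.Decidable using (decidable-stable; map′; _×-dec_)

module _ {A : Set} where

  Unique-resp-↭ : {xs ys : List A} → xs ↭ ys → Unique xs → Unique ys
  Unique-resp-↭ p = PermutationSetoid.Unique-resp-↭ (setoid A) (↭⇒↭ₛ p)

  ∉∈⇒≢ : {x y : A} {xs : List A} → x ∉ xs → y ∈ xs → x ≢ y
  ∉∈⇒≢ x∉ y∈ refl = x∉ y∈

  ∈∉⇒≢ : {x y : A} {xs : List A} → x ∈ xs → y ∉ xs → x ≢ y
  ∈∉⇒≢ x∈ y∉ refl = y∉ x∈

  Unique-++ˡ : (xs : List A) {ys : List A} → Unique (xs ++ ys) → Unique xs
  Unique-++ˡ []       _       = []
  Unique-++ˡ (x ∷ xs) (a ∷ u) = ++⁻ˡ xs a ∷ Unique-++ˡ xs u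

  Unique-++ʳ : (xs : List A) {ys : List A} → Unique (xs ++ ys) → Unique ys
  Unique-++ʳ []       u       = u
  Unique-++ʳ (x ∷ xs) (_ ∷ u) = Unique-++ʳ xs u

  Unique-++-disjoint : (xs : List A) {ys : List A} {x : A} → Unique (xs ++ ys) → x ∈ xs → x ∉ ys
  Unique-++-disjoint (y ∷ xs) (a ∷ u) (here refl) = All¬⇒¬Any (++⁻ʳ xs a)
  Unique-++-disjoint (y ∷ xs) (a ∷ u) (there x∈)  = Unique-++-disjoint xs u x∈

  Unique-++-∷-disjoint : (xs : List A) {x y : A} {ys : List A} → Unique (xs ++ x ∷ ys) → y ∈ xs ++ [ x ] → y ∉ ys
  Unique-++-∷-disjoint xs {x} {ys = ys} u =
    Unique-++-disjoint (xs ++ [ x ]) (subst Unique (sym (List.++-assoc xs [ x ] ys)) u)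

  Unique-middle : (xs : List A) {ys : List A} {x : A} → Unique (xs ++ x ∷ ys) → x ∉ xs × x ∉ ys
  Unique-middle xs u =
    (λ x∈xs → Unique-++-disjoint xs u x∈xs (here refl)) , Unique[x∷xs]⇒x∉xs (Unique-++ʳ xs u)

  ∈-++-middle : (xs : List A) {ys : List A} {x y : A} → y ∈ xs ++ x ∷ ys → y ≢ x → y ∈ xs ⊎ y ∈ ys
  ∈-++-middle xs y∈ y≢x with ∈-++⁻ xs y∈
  ... | inj₁ y∈xs         = inj₁ y∈xs
  ... | inj₂ (here y≡x)   = ⊥-elim (y≢x y≡x)
  ... | inj₂ (there y∈ys) = inj₂ y∈ys

  Unique⇒length≤ : {xs ys : List A} → Unique xs → (∀ {z} → z ∈ xs → z ∈ ys) → length xs ≤ length ys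
  Unique⇒length≤ {[]}     _       _  = z≤n
  Unique⇒length≤ {x ∷ xs} (a ∷ u) xs⊆ys with ∈-∃++ (xs⊆ys (here refl))
  ... | ys₁ , ys₂ , refl = begin
      suc (length xs)           ≤⟨ s≤s (Unique⇒length≤ u xs⊆ys₁ys₂) ⟩
      suc (length (ys₁ ++ ys₂)) ≡⟨ ↭-length (shift x ys₁ ys₂) ⟨
      length (ys₁ ++ x ∷ ys₂)   ∎
    where
      open ℕ.≤-Reasoning
      xs⊆ys₁ys₂ : ∀ {z} → z ∈ xs → z ∈ ys₁ ++ ys₂
      xs⊆ys₁ys₂ z∈ with ∈-++-middle ys₁ (xs⊆ys (there z∈)) (λ { refl → All¬⇒¬Any a z∈ })
      ... | inj₁ z∈ys₁ = ∈-++⁺ˡ z∈ys₁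
      ... | inj₂ z∈ys₂ = ∈-++⁺ʳ ys₁ z∈ys₂

  ∈⇒length≥1 : {x : A} {xs : List A} → x ∈ xs → length xs ≥ 1
  ∈⇒length≥1 (here _)  = s≤s z≤n
  ∈⇒length≥1 (there _) = s≤s z≤n

  Precedes : List A → A → A → Set
  Precedes xs a b = Σ (List A) λ X → Σ (List A) λ Y → Σ (List A) λ Z → xs ≡ X ++ a ∷ Y ++ b ∷ Z

  precedes⊎follows : (xs : List A) {a b : A} → a ∈ xs → b ∈ xs → a ≢ b → Precedes xs a b ⊎ Precedes xs b a
  precedes⊎follows xs a∈ b∈ a≢b with ∈-∃++ a∈
  ... | X , D , refl with ∈-++-middle X b∈ (λ b≡a → a≢b (sym b≡a))
  ...   | inj₂ b∈D with ∈-∃++ b∈D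
  ...     | Y , Z , refl = inj₁ (X , Y , Z , refl)
  precedes⊎follows xs {a} {b} a∈ b∈ a≢b | X , D , refl | inj₁ b∈X with ∈-∃++ b∈X
  ...     | X₁ , X₂ , refl = inj₂ (X₁ , X₂ , D , List.++-assoc X₁ (b ∷ X₂) (a ∷ D))

  Around : List A → A → A → A → Set
  Around xs u m w = Σ (List A) λ X → Σ (List A) λ Y → xs ≡ X ++ m ∷ Y × u ∈ X × w ∈ Y

  Precedes⇒Around-before : ∀ {xs m u w} L R → xs ≡ L ++ m ∷ R → Precedes L u w → Around xs u w m
  Precedes⇒Around-before {xs} {m} {u} {w} _ R xs≡ (X , Y , Z , refl) =
    X ++ u ∷ Y , Z ++ m ∷ R , xs≡′ , ∈-++⁺ʳ X (here refl) , ∈-++⁺ʳ Z (here refl)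
    where
      open ≡-Reasoning
      xs≡′ : xs ≡ (X ++ u ∷ Y) ++ w ∷ Z ++ m ∷ R
      xs≡′ = begin
        xs                                 ≡⟨ xs≡ ⟩
        (X ++ u ∷ Y ++ w ∷ Z) ++ m ∷ R     ≡⟨ List.++-assoc X (u ∷ Y ++ w ∷ Z) (m ∷ R) ⟩
        X ++ u ∷ (Y ++ w ∷ Z) ++ m ∷ R     ≡⟨ cong (λ T → X ++ u ∷ T) (List.++-assoc Y (w ∷ Z) (m ∷ R)) ⟩
        X ++ u ∷ Y ++ w ∷ Z ++ m ∷ R       ≡⟨ List.++-assoc X (u ∷ Y) (w ∷ Z ++ m ∷ R) ⟨
        (X ++ u ∷ Y) ++ w ∷ Z ++ m ∷ R     ∎

  Precedes⇒Around-after : ∀ {xs m u w} L R → xs ≡ L ++ m ∷ R → Precedes R u w → Around xs m u w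
  Precedes⇒Around-after {m = m} {u} {w} L _ xs≡ (X , Y , Z , refl) =
    L ++ m ∷ X , Y ++ w ∷ Z , trans xs≡ (sym (List.++-assoc L (m ∷ X) (u ∷ Y ++ w ∷ Z))) ,
    ∈-++⁺ʳ L (here refl) , ∈-++⁺ʳ Y (here refl)

module Paths (G : Graph) where

  V : Set
  V = Fin (n G)

  open import Data.List.Membership.DecPropositional (_≟ᶠ_ {n G}) using (_∈?_) public
  open import Data.List.Relation.Unary.Unique.DecPropositional (_≟ᶠ_ {n G}) using (unique?)

  adj? : (u v : V) → Dec (Adj G u v)
  adj? u v = adj G u v Bool.≟ true

  Adj-sym : {u v : V} → Adj G u v → Adj G v u
  Adj-sym {u} {v} u∼v = trans (adj-sym G v u) u∼v

  Adj⇒≢ : {u v : V} → Adj G u v → u ≢ v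
  Adj⇒≢ {u} u∼u refl with trans (sym u∼u) (irrefl G u)
  ... | ()

  data Route : V → List V → V → Set where
    stop : ∀ {a} → Route a [ a ] a
    link : ∀ {a b xs t} → Adj G a b → Route b xs t → Route a (a ∷ xs) t

  Route⇒Chain : ∀ {a xs b} → Route a xs b → Chain G xs
  Route⇒Chain stop                   = [-]
  Route⇒Chain (link a∼b stop)        = a∼b ∷ [-]
  Route⇒Chain (link a∼b r@(link _ _)) = a∼b ∷ Route⇒Chain r

  Chain⇒Route : ∀ {x xs} → Chain G (x ∷ xs) → ∃[ t ] Route x (x ∷ xs) t
  Chain⇒Route [-] = _ , stop
  Chain⇒Route (x∼y ∷ c) with Chain⇒Route c
  ... | t , r = t , link x∼y r

  Route⇒IsPath : ∀ {a xs b} → Route a xs b → Unique xs → IsPath G xs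
  Route⇒IsPath stop       u = s≤s z≤n , u , [-]
  Route⇒IsPath r@(link _ _) u = s≤s z≤n , u , Route⇒Chain r

  head∈ : ∀ {a xs b} → Route a xs b → a ∈ xs
  head∈ stop       = here refl
  head∈ (link _ _) = here refl

  last∈ : ∀ {a xs b} → Route a xs b → b ∈ xs
  last∈ stop       = here refl
  last∈ (link _ r) = there (last∈ r)

  head≡ : ∀ {a x xs b} → Route a (x ∷ xs) b → a ≡ x
  head≡ stop       = refl
  head≡ (link _ _) = refl

  join : ∀ {a xs b c ys d} → Route a xs b → Adj G b c → Route c ys d → Route a (xs ++ ys) d
  join stop       b∼c r′ = link b∼c r′
  join (link e r) b∼c r′ = link e (join r b∼c r′)

  snoc : ∀ {a xs b c} → Route a xs b → Adj G b c → Route a (xs ++ [ c ]) c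
  snoc r b∼c = join r b∼c stop

  Route-reverse : ∀ {a xs b} → Route a xs b → Route b (reverse xs) a
  Route-reverse stop = stop
  Route-reverse {a} (link {xs = xs} a∼b r) rewrite List.unfold-reverse a xs =
    snoc (Route-reverse r) (Adj-sym a∼b)

  split : ∀ A {x B s t} → Route s (A ++ x ∷ B) t → Route s (A ++ [ x ]) x × Route x (x ∷ B) t
  split []            stop       = stop , stop
  split []            (link e r) = stop , link e r
  split (a ∷ [])     (link e r) = map₁ (link e) (split [] r)
  split (a ∷ a′ ∷ A) (link e r) = map₁ (link e) (split (a′ ∷ A) r)

  Route-unsnoc : ∀ A {s x} → Route s (A ++ [ x ]) x → (A ≡ [] × s ≡ x) ⊎ ∃[ ℓ ] (Route s A ℓ × Adj G ℓ x)
  Route-unsnoc []            stop                = inj₁ (refl , refl)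
  Route-unsnoc []            (link _ ())
  Route-unsnoc (a ∷ [])      (link a∼x stop)     = inj₂ (a , stop , a∼x)
  Route-unsnoc (a ∷ a′ ∷ A) (link e r) with Route-unsnoc (a′ ∷ A) r
  ... | inj₂ (ℓ , r′ , ℓ∼x) = inj₂ (ℓ , link e r′ , ℓ∼x)

  Route-uncons : ∀ {x B t} → Route x (x ∷ B) t → (B ≡ [] × x ≡ t) ⊎ ∃[ y ] (Adj G x y × Route y B t)
  Route-uncons stop       = inj₁ (refl , refl)
  Route-uncons (link e r) = inj₂ (_ , e , r)

  Route-tail : ∀ {a x xs t} → Route a (a ∷ x ∷ xs) t → Route x (x ∷ xs) t
  Route-tail (link _ r) with head≡ r
  ... | refl = r

  Route-loop : ∀ {a xs} → Route a xs a → Unique xs → xs ≡ [ a ]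
  Route-loop stop       _ = refl
  Route-loop (link _ r) u = ⊥-elim (Unique[x∷xs]⇒x∉xs u (last∈ r))

  Chain-++⁻ˡ : ∀ xs {ys} → Chain G (xs ++ ys) → Chain G xs
  Chain-++⁻ˡ []           _       = []
  Chain-++⁻ˡ (x ∷ [])     _       = [-]
  Chain-++⁻ˡ (x ∷ y ∷ xs) (e ∷ c) = e ∷ Chain-++⁻ˡ (y ∷ xs) c

  Chain-++⁻ʳ : ∀ xs {ys} → Chain G (xs ++ ys) → Chain G ys
  Chain-++⁻ʳ []           c       = c
  Chain-++⁻ʳ (x ∷ [])     [-]     = []
  Chain-++⁻ʳ (x ∷ [])     (_ ∷ c) = c
  Chain-++⁻ʳ (x ∷ y ∷ xs) (_ ∷ c) = Chain-++⁻ʳ (y ∷ xs) c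

  WalkIn-start : ∀ {S a b} → WalkIn G S a b → S a
  WalkIn-start (here s)     = s
  WalkIn-start (step s _ _) = s

  WalkIn-++ : ∀ {S a b c} → WalkIn G S a b → WalkIn G S b c → WalkIn G S a c
  WalkIn-++ (here _)     w′ = w′
  WalkIn-++ (step s e w) w′ = step s e (WalkIn-++ w w′)

  WalkIn-reverse : ∀ {S a b} → WalkIn G S a b → WalkIn G S b a
  WalkIn-reverse (here s)     = here s
  WalkIn-reverse (step s e w) = WalkIn-++ (WalkIn-reverse w) (step (WalkIn-start w) (Adj-sym e) (here s))

  WalkIn-edge : ∀ {S a b} → S a → S b → Adj G a b → WalkIn G S a b
  WalkIn-edge sa sb a∼b = step sa a∼b (here sb)

  WalkIn-closed : ∀ {S} (C : V → Set) → (∀ {u w} → C u → S u → S w → Adj G u w → C w) →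
                  ∀ {a b} → C a → WalkIn G S a b → C b
  WalkIn-closed C closed ca (here _)     = ca
  WalkIn-closed C closed ca (step s e w) = WalkIn-closed C closed (closed ca s (WalkIn-start w) e) w

  WalkIn-exit : ∀ {S} (C : V → Set) → (∀ v → Dec (C v)) → ∀ {a b} → C a → ¬ C b → WalkIn G S a b →
                ∃[ u ] ∃[ w ] (C u × ¬ C w × Adj G u w)
  WalkIn-exit C C? ca ¬cb (here _) = ⊥-elim (¬cb ca)
  WalkIn-exit C C? {a} ca ¬cb (step {w = w} _ a∼w walk) with C? w
  ... | yes cw = WalkIn-exit C C? cw ¬cb walk
  ... | no ¬cw = a , w , ca , ¬cw , a∼w

  Chain⇒WalkIn : ∀ {S xs} → Chain G xs → All S xs → ∀ {y z} → y ∈ xs → z ∈ xs → WalkIn G S y z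
  Chain⇒WalkIn {S} {x ∷ xs} c all y∈ z∈ =
    WalkIn-++ (WalkIn-reverse (from-head (proj₂ (Chain⇒Route c)) all y∈)) (from-head (proj₂ (Chain⇒Route c)) all z∈)
    where
      from-head : ∀ {a ys b} → Route a ys b → All S ys → ∀ {y} → y ∈ ys → WalkIn G S a y
      from-head stop       (sa ∷ []) (here refl) = here sa
      from-head (link _ _) (sa ∷ _)  (here refl) = here sa
      from-head (link e r) (sa ∷ al) (there y∈)  = step sa e (from-head r al y∈)

  ¬TwoComponents : ∀ {x a b d} → ¬ WalkIn G (Minus G x) a b → ¬ WalkIn G (Minus G x) a d →
                   ¬ WalkIn G (Minus G x) b d → a ≢ x → b ≢ x → d ≢ x → ¬ TwoComponents G x
  ¬TwoComponents {x} {a} {b} {d} ¬a⇝b ¬a⇝d ¬b⇝d a≢x b≢x d≢x (u , v , _ , _ , _ , reach) =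
    pigeonhole (reach _ a≢x) (reach _ b≢x) (reach _ d≢x)
    where
      W = WalkIn G (Minus G x)
      joined : ∀ {s y z} → W s y → W s z → W y z
      joined s⇝y s⇝z = WalkIn-++ (WalkIn-reverse s⇝y) s⇝z
      pigeonhole : W u a ⊎ W v a → W u b ⊎ W v b → W u d ⊎ W v d → ⊥
      pigeonhole (inj₁ u⇝a) (inj₁ u⇝b) _          = ¬a⇝b (joined u⇝a u⇝b)
      pigeonhole (inj₂ v⇝a) (inj₂ v⇝b) _          = ¬a⇝b (joined v⇝a v⇝b)
      pigeonhole (inj₁ u⇝a) (inj₂ _)   (inj₁ u⇝d) = ¬a⇝d (joined u⇝a u⇝d)
      pigeonhole (inj₁ _)   (inj₂ v⇝b) (inj₂ v⇝d) = ¬b⇝d (joined v⇝b v⇝d)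
      pigeonhole (inj₂ v⇝a) (inj₁ _)   (inj₂ v⇝d) = ¬a⇝d (joined v⇝a v⇝d)
      pigeonhole (inj₂ _)   (inj₁ u⇝b) (inj₁ u⇝d) = ¬b⇝d (joined u⇝b u⇝d)

  clique⇒Chain : ∀ {xs} → Unique xs → (∀ {x y} → x ∈ xs → y ∈ xs → x ≢ y → Adj G x y) → Chain G xs
  clique⇒Chain {[]}         _                 _      = []
  clique⇒Chain {x ∷ []}     _                 _      = [-]
  clique⇒Chain {x ∷ y ∷ xs} ((x≢y ∷ _) ∷ u) clique =
    clique (here refl) (there (here refl)) x≢y ∷ clique⇒Chain u (λ x∈ y∈ → clique (there x∈) (there y∈))

  edge-between? : (xs ys : List V) → Dec (∃[ u ] ∃[ v ] (u ∈ xs × v ∈ ys × Adj G u v))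
  edge-between? xs ys = map′ found lose₂ (Any.any? (λ u → Any.any? (adj? u) ys) xs)
    where
      found : Any.Any (λ u → Any.Any (Adj G u) ys) xs → ∃[ u ] ∃[ v ] (u ∈ xs × v ∈ ys × Adj G u v)
      found any-u with find any-u
      ... | u , u∈ , any-v with find any-v
      ...   | v , v∈ , u∼v = u , v , u∈ , v∈ , u∼v
      lose₂ : ∃[ u ] ∃[ v ] (u ∈ xs × v ∈ ys × Adj G u v) → Any.Any (λ u → Any.Any (Adj G u) ys) xs
      lose₂ (u , v , u∈ , v∈ , u∼v) = lose u∈ (lose v∈ u∼v)

  spanning⊎missing : (xs : List V) → (∀ v → v ∈ xs) ⊎ ∃[ v ] v ∉ xs
  spanning⊎missing xs with Fin.all? (_∈? xs)
  ... | yes all∈ = inj₁ all∈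
  ... | no ¬all∈ = inj₂ (Fin.¬∀⟶∃¬ _ _ (_∈? xs) ¬all∈)

  chain? : (xs : List V) → Dec (Chain G xs)
  chain? []           = yes []
  chain? (x ∷ [])     = yes [-]
  chain? (x ∷ y ∷ xs) with adj? x y | chain? (y ∷ xs)
  ... | yes x∼y | yes c = yes (x∼y ∷ c)
  ... | no x≁y  | _     = no λ { (x∼y ∷ _) → x≁y x∼y }
  ... | yes _   | no ¬c = no λ { (_ ∷ c) → ¬c c }

  isPath? : (xs : List V) → Dec (IsPath G xs)
  isPath? xs = (1 ℕ.≤? length xs) ×-dec (unique? xs ×-dec chain? xs)

  listsUpTo : ℕ → List (List V)
  listsUpTo zero    = [ [] ]
  listsUpTo (suc k) = [] ∷ cartesianProductWith _∷_ (allFin (n G)) (listsUpTo k)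

  ∈-listsUpTo : ∀ k (xs : List V) → length xs ≤ k → xs ∈ listsUpTo k
  ∈-listsUpTo zero    []       _          = here refl
  ∈-listsUpTo (suc k) []       _          = here refl
  ∈-listsUpTo (suc k) (x ∷ xs) (s≤s len≤) =
    there (∈-cartesianProductWith⁺ _∷_ (∈-allFin x) (∈-listsUpTo k xs len≤))

  IsPath⇒length≤ : ∀ {p} → IsPath G p → length p ≤ n G
  IsPath⇒length≤ (_ , u , _) =
    ℕ.≤-trans (Unique⇒length≤ u (λ {z} _ → ∈-allFin z)) (ℕ.≤-reflexive (List.length-tabulate (λ i → i)))

  Longest : List V → Set
  Longest p = ∀ q → IsPath G q → length q ≤ length p

  longestPath : V → Σ (List V) λ p → IsPath G p × Longest p
  longestPath v = p , argmax-all length path-v (all-filter isPath? candidates) , p-longest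
    where
      path-v : IsPath G [ v ]
      path-v = s≤s z≤n , [] ∷ [] , [-]
      candidates = listsUpTo (n G)
      p = argmax length [ v ] (filter isPath? candidates)
      p-longest : Longest p
      p-longest q q-path = All.lookup (f[xs]≤f[argmax] [ v ] (filter isPath? candidates))
        (∈-filter⁺ isPath? (∈-listsUpTo (n G) q (IsPath⇒length≤ q-path)) q-path)

module Necessity (G : Graph) where
  open Paths G

  module OnHamiltonianPath {p : List V} (p-unique : Unique p) (p-chain : Chain G p) (p-spans : ∀ v → v ∈ p) where

    module Cut {m : V} (A B : List V) (p≡ : p ≡ A ++ m ∷ B) where

      private
        unique : Unique (A ++ m ∷ B)
        unique = subst Unique p≡ p-unique

        chain : Chain G (A ++ m ∷ B)
        chain = subst (Chain G) p≡ p-chain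

      A≢m : ∀ {v} → v ∈ A → v ≢ m
      A≢m v∈A refl = proj₁ (Unique-middle A unique) v∈A

      B≢m : ∀ {v} → v ∈ B → v ≢ m
      B≢m v∈B refl = proj₂ (Unique-middle A unique) v∈B

      side : ∀ w → w ≢ m → w ∈ A ⊎ w ∈ B
      side w w≢m = ∈-++-middle A (subst (w ∈_) p≡ (p-spans w)) w≢m

      walk-in-A : ∀ {y z} → y ∈ A → z ∈ A → WalkIn G (Minus G m) y z
      walk-in-A = Chain⇒WalkIn (Chain-++⁻ˡ A chain) (All.tabulate A≢m)

      walk-in-B : ∀ {y z} → y ∈ B → z ∈ B → WalkIn G (Minus G m) y z
      walk-in-B = Chain⇒WalkIn (Chain-++⁻ʳ [ m ] (Chain-++⁻ʳ A chain)) (All.tabulate B≢m)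

      ¬Articulation : ∀ {a b} → a ∈ A → b ∈ B → WalkIn G (Minus G m) a b → ¬ Articulation G m
      ¬Articulation {a} a∈A b∈B a⇝b (u , v , u≢m , v≢m , ¬u⇝v) =
        ¬u⇝v (WalkIn-++ (WalkIn-reverse (from-a u u≢m)) (from-a v v≢m))
        where
          from-a : ∀ w → w ≢ m → WalkIn G (Minus G m) a w
          from-a w w≢m with side w w≢m
          ... | inj₁ w∈A = walk-in-A a∈A w∈A
          ... | inj₂ w∈B = WalkIn-++ a⇝b (walk-in-B b∈B w∈B)

      twoComponents : ∀ {a b} → a ∈ A → b ∈ B → Articulation G m → TwoComponents G m
      twoComponents a∈A b∈B art =
        _ , _ , A≢m a∈A , B≢m b∈B , (λ a⇝b → ¬Articulation a∈A b∈B a⇝b art) ,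
        λ w w≢m → Sum.map (walk-in-A a∈A) (walk-in-B b∈B) (side w w≢m)

      Articulation⇒TwoComponents : Articulation G m → TwoComponents G m
      Articulation⇒TwoComponents art@(u , v , u≢m , v≢m , ¬u⇝v) with side u u≢m | side v v≢m
      ... | inj₁ u∈A | inj₁ v∈A = ⊥-elim (¬u⇝v (walk-in-A u∈A v∈A))
      ... | inj₂ u∈B | inj₂ v∈B = ⊥-elim (¬u⇝v (walk-in-B u∈B v∈B))
      ... | inj₁ u∈A | inj₂ v∈B = twoComponents u∈A v∈B art
      ... | inj₂ u∈B | inj₁ v∈A = twoComponents v∈A u∈B art

    condA : CondA G
    condA x art with ∈-∃++ (p-spans x)
    ... | A , B , p≡ = Cut.Articulation⇒TwoComponents A B p≡ art

    Around⇒¬Articulation : ∀ {u m w} → Around p u m w → Adj G u w → ¬ Articulation G m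
    Around⇒¬Articulation (X , Y , p≡ , u∈X , w∈Y) u∼w =
      ¬Articulation u∈X w∈Y (WalkIn-edge (A≢m u∈X) (B≢m w∈Y) u∼w)
      where open Cut X Y p≡

    condB : CondB G
    condB (x , y , z , art-x , art-y , art-z , x∼y , y∼z , x∼z) with ∈-∃++ (p-spans y)
    ... | A , B , p≡ = by-sides (side x (Adj⇒≢ x∼y)) (side z (Adj⇒≢ (Adj-sym y∼z)))
      where
        open Cut A B p≡ using (side)
        by-sides : x ∈ A ⊎ x ∈ B → z ∈ A ⊎ z ∈ B → ⊥
        by-sides (inj₁ x∈A) (inj₂ z∈B) = Around⇒¬Articulation (A , B , p≡ , x∈A , z∈B) x∼z art-y
        by-sides (inj₂ x∈B) (inj₁ z∈A) = Around⇒¬Articulation (A , B , p≡ , z∈A , x∈B) (Adj-sym x∼z) art-y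
        by-sides (inj₁ x∈A) (inj₁ z∈A) with precedes⊎follows A x∈A z∈A (Adj⇒≢ x∼z)
        ... | inj₁ x≺z = Around⇒¬Articulation (Precedes⇒Around-before A B p≡ x≺z) x∼y art-z
        ... | inj₂ z≺x = Around⇒¬Articulation (Precedes⇒Around-before A B p≡ z≺x) (Adj-sym y∼z) art-x
        by-sides (inj₂ x∈B) (inj₂ z∈B) with precedes⊎follows B x∈B z∈B (Adj⇒≢ x∼z)
        ... | inj₁ x≺z = Around⇒¬Articulation (Precedes⇒Around-after A B p≡ x≺z) y∼z art-x
        ... | inj₂ z≺x = Around⇒¬Articulation (Precedes⇒Around-after A B p≡ z≺x) (Adj-sym x∼y) art-z

  HamiltonianPath⇒CondA×CondB : HamiltonianPath G → CondA G × CondB G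
  HamiltonianPath⇒CondA×CondB (p , (_ , p-unique , p-chain) , p-spans) = condA , condB
    where open OnHamiltonianPath p-unique p-chain p-spans

module Sufficiency (G : Graph) (4K₁-free : FourK1Free G) where
  open Paths G
  open import Algebra.Solver.CommutativeMonoid (++-commutativeMonoid {A = V}) using (solve; _⊕_; _⊜_)

  Adj-from-4K₁-freeness : ∀ {a b c d} → a ≢ b → a ≢ c → a ≢ d → b ≢ c → b ≢ d → c ≢ d →
    ¬ Adj G a b → ¬ Adj G a c → ¬ Adj G a d → ¬ Adj G b c → ¬ Adj G b d → Adj G c d
  Adj-from-4K₁-freeness {a} {b} {c} {d} a≢b a≢c a≢d b≢c b≢d c≢d a≁b a≁c a≁d b≁c b≁d =
    decidable-stable (adj? c d) λ c≁d →
      4K₁-free (a , b , c , d , a≢b , a≢c , a≢d , b≢c , b≢d , c≢d , a≁b , a≁c , a≁d , b≁c , b≁d , c≁d)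

  module Maximal {p₁ pₖ : V} {P : List V} (route-P : Route p₁ P pₖ) (unique : Unique P) (longest : Longest P) where

    ¬longer₁ : ∀ {Q a b r} → Route a Q b → Q ↭ r ∷ P → r ∉ P → ⊥
    ¬longer₁ {Q} route-Q Q↭ r∉P = ℕ.1+n≰n (subst (_≤ length P) (↭-length Q↭) (longest Q Q-path))
      where Q-path = Route⇒IsPath route-Q (Unique-resp-↭ (↭-sym Q↭) (¬Any⇒All¬ P r∉P ∷ unique))

    ¬longer₂ : ∀ {Q a b r r′} → Route a Q b → Q ↭ r ∷ r′ ∷ P → r ∉ P → r′ ∉ P → r ≢ r′ → ⊥
    ¬longer₂ {Q} route-Q Q↭ r∉P r′∉P r≢r′ =
      ℕ.1+n≰n (ℕ.≤-trans (ℕ.n≤1+n _) (subst (_≤ length P) (↭-length Q↭) (longest Q Q-path)))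
      where Q-path = Route⇒IsPath route-Q
              (Unique-resp-↭ (↭-sym Q↭) ((r≢r′ ∷ ¬Any⇒All¬ P r∉P) ∷ ¬Any⇒All¬ P r′∉P ∷ unique))

    outside≁first : ∀ {r} → r ∉ P → ¬ Adj G r p₁
    outside≁first r∉P r∼p₁ = ¬longer₁ (link r∼p₁ route-P) ↭-refl r∉P

    last≁outside : ∀ {r} → r ∉ P → ¬ Adj G pₖ r
    last≁outside {r} r∉P pₖ∼r = ¬longer₁ (snoc route-P pₖ∼r) (++-comm P [ r ]) r∉P

  record Setting : Set where
    field
      L R : List V
      {p₁ ℓ c ρ pₖ r₀} : V
      route-L : Route p₁ L ℓ
      ℓ∼c : Adj G ℓ c
      c∼ρ : Adj G c ρ
      route-R : Route ρ R pₖ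
      unique : Unique (L ++ c ∷ R)
      longest : Longest (L ++ c ∷ R)
      r₀∉ : r₀ ∉ L ++ c ∷ R
      r₀∼c : Adj G r₀ c

  mirror : Setting → Setting
  mirror S = record
    { L = reverse R ; R = reverse L
    ; route-L = Route-reverse route-R ; ℓ∼c = Adj-sym c∼ρ ; c∼ρ = Adj-sym ℓ∼c ; route-R = Route-reverse route-L
    ; unique = Unique-resp-↭ (↭-sym reversed↭) unique
    ; longest = λ Q Q-path → ℕ.≤-trans (longest Q Q-path) (ℕ.≤-reflexive (sym (↭-length reversed↭)))
    ; r₀∉ = λ r₀∈ → r₀∉ (∈-resp-↭ reversed↭ r₀∈)
    ; r₀∼c = r₀∼c
    }
    where
      open Setting S
      reversed↭ : reverse R ++ c ∷ reverse L ↭ L ++ c ∷ R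
      reversed↭ = ↭-trans (++⁺ (↭-reverse R) (↭-prep c (↭-reverse L)))
                    (solve 3 (λ R c L → R ⊕ (c ⊕ L) ⊜ L ⊕ (c ⊕ R)) ↭-refl R [ c ] L)

  module Split (S : Setting) where
    open Setting S public

    P : List V
    P = L ++ c ∷ R

    route-P : Route p₁ P pₖ
    route-P = join route-L ℓ∼c (link c∼ρ route-R)

    open Maximal route-P unique longest public

    L⊆P : ∀ {x} → x ∈ L → x ∈ P
    L⊆P = ∈-++⁺ˡ

    R⊆P : ∀ {x} → x ∈ R → x ∈ P
    R⊆P x∈R = ∈-++⁺ʳ L (there x∈R)

    c∈P : c ∈ P
    c∈P = ∈-++⁺ʳ L (here refl)

    L≢c : ∀ {x} → x ∈ L → x ≢ c
    L≢c x∈L refl = proj₁ (Unique-middle L unique) x∈L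

    R≢c : ∀ {x} → x ∈ R → x ≢ c
    R≢c x∈R refl = proj₂ (Unique-middle L unique) x∈R

    L∉R : ∀ {x} → x ∈ L → x ∉ R
    L∉R x∈L x∈R = Unique-++-disjoint L unique x∈L (there x∈R)

    L≢R : ∀ {x y} → x ∈ L → y ∈ R → x ≢ y
    L≢R x∈L y∈R refl = L∉R x∈L y∈R

    p₁∈L : p₁ ∈ L
    p₁∈L = head∈ route-L

    pₖ∈R : pₖ ∈ R
    pₖ∈R = last∈ route-R

    p₁≁pₖ : ¬ Adj G p₁ pₖ
    p₁≁pₖ p₁∼pₖ = ¬longer₁ (link r₀∼c (Route-reverse (join route-R (Adj-sym p₁∼pₖ) (snoc route-L ℓ∼c))))
      (↭-prep r₀ (↭-trans (↭-reverse (R ++ L ++ [ c ]))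
                          (solve 3 (λ R L c → R ⊕ (L ⊕ c) ⊜ L ⊕ (c ⊕ R)) ↭-refl R L [ c ]))) r₀∉

    outside-adjacent : ∀ {r r′} → r ∉ P → r′ ∉ P → r ≢ r′ → Adj G r r′
    outside-adjacent r∉P r′∉P r≢r′ = Adj-from-4K₁-freeness
      (L≢R p₁∈L pₖ∈R) (∈∉⇒≢ (L⊆P p₁∈L) r∉P) (∈∉⇒≢ (L⊆P p₁∈L) r′∉P)
      (∈∉⇒≢ (R⊆P pₖ∈R) r∉P) (∈∉⇒≢ (R⊆P pₖ∈R) r′∉P) r≢r′
      p₁≁pₖ (λ p₁∼r → outside≁first r∉P (Adj-sym p₁∼r)) (λ p₁∼r′ → outside≁first r′∉P (Adj-sym p₁∼r′))
      (last≁outside r∉P) (last≁outside r′∉P)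

    ¬detour : ∀ {X Y s a b t r r′} → Route s X a → Route b Y t → X ++ Y ↭ P →
              r ∉ P → r′ ∉ P → Adj G a r → Adj G r′ b → ⊥
    ¬detour {X} {Y} {r = r} {r′} route-X route-Y XY↭P r∉P r′∉P a∼r r′∼b with r ≟ᶠ r′
    ... | yes refl = ¬longer₁ (join (snoc route-X a∼r) r′∼b route-Y)
      (↭-trans (solve 3 (λ X r Y → (X ⊕ r) ⊕ Y ⊜ r ⊕ (X ⊕ Y)) ↭-refl X [ r ] Y) (↭-prep r XY↭P)) r∉P
    ... | no r≢r′ = ¬longer₂ (join (snoc route-X a∼r) (outside-adjacent r∉P r′∉P r≢r′) (link r′∼b route-Y))
      (↭-trans (solve 4 (λ X r r′ Y → (X ⊕ r) ⊕ (r′ ⊕ Y) ⊜ r ⊕ (r′ ⊕ (X ⊕ Y))) ↭-refl X [ r ] [ r′ ] Y)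
               (↭-prep r (↭-prep r′ XY↭P))) r∉P r′∉P r≢r′

    split-P : ∀ A {a Y} → P ≡ A ++ a ∷ Y → Route p₁ (A ++ [ a ]) a × Route a (a ∷ Y) pₖ
    split-P A P≡ = split A (subst (λ Q → Route p₁ Q pₖ) P≡ route-P)

    ↭-split-P : ∀ A {a Y Y′} → P ≡ A ++ a ∷ Y → Y′ ↭ Y → (A ++ [ a ]) ++ Y′ ↭ P
    ↭-split-P A {a} P≡ Y′↭Y = ↭-trans (++⁺ˡ (A ++ [ a ]) Y′↭Y) (↭-reflexive (trans (List.++-assoc A [ a ] _) (sym P≡)))

    -- If b follows a directly, p₁ … a r r′ b … pₖ (with r′ dropped when r = r′) is longer than P.
    -- Otherwise, with a′ the successor of a and b′ that of b, so is p₁ … a r r′ b … a′ pₖ … b′,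
    -- where a′ ∼ pₖ comes from 4K₁-freeness applied to p₁, r, pₖ, a′.
    ¬attached : ∀ {r r′ a b} A B Cs → P ≡ A ++ a ∷ B ++ b ∷ Cs →
                r ∉ P → r′ ∉ P → Adj G r a → Adj G r′ b → ⊥
    ¬attached {a = a} A [] Cs P≡ r∉P r′∉P r∼a r′∼b =
      ¬detour (proj₁ (split-P A P≡)) (proj₂ (split [ a ] (proj₂ (split-P A P≡)))) (↭-split-P A P≡ ↭-refl)
              r∉P r′∉P (Adj-sym r∼a) r′∼b
    ¬attached {r} {r′} {a} {b} A (a′ ∷ B′) Cs P≡ r∉P r′∉P r∼a r′∼b
      with Route-uncons (proj₂ (split (a ∷ a′ ∷ B′) (proj₂ (split-P A P≡))))
    ... | inj₁ (_ , refl) = last≁outside r′∉P (Adj-sym r′∼b)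
    ... | inj₂ (b′ , _ , route-Cs) =
      ¬detour route-A (join (Route-reverse route-a′b) a′∼pₖ (Route-reverse route-Cs))
              (↭-split-P A P≡ (↭-trans (++⁺ (↭-reverse (a′ ∷ B′ ++ [ b ])) (↭-reverse Cs))
                                       (↭-reflexive (List.++-assoc (a′ ∷ B′) [ b ] Cs))))
              r∉P r′∉P (Adj-sym r∼a) r′∼b
      where
        route-A = proj₁ (split-P A P≡)
        route-a′ = Route-tail (proj₂ (split-P A P≡))
        route-a′b = proj₁ (split (a′ ∷ B′) route-a′)

        r≁a′ : ¬ Adj G r a′
        r≁a′ r∼a′ = ¬detour route-A route-a′ (↭-split-P A P≡ ↭-refl) r∉P r∉P (Adj-sym r∼a) r∼a′

        p₁≁a′ : ¬ Adj G p₁ a′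
        p₁≁a′ p₁∼a′ = ¬longer₁ (link r∼a (join (Route-reverse route-A) p₁∼a′ route-a′))
          (↭-prep r (↭-trans (++⁺ʳ _ (↭-reverse (A ++ [ a ]))) (↭-split-P A P≡ ↭-refl))) r∉P

        unique′ : Unique (A ++ a ∷ a′ ∷ B′ ++ b ∷ Cs)
        unique′ = subst Unique P≡ unique

        a′∉⋯ : a′ ∉ B′ ++ b ∷ Cs
        a′∉⋯ with Unique-++ʳ A unique′
        ... | _ ∷ u = Unique[x∷xs]⇒x∉xs u

        a′∈P : a′ ∈ P
        a′∈P = subst (a′ ∈_) (sym P≡) (∈-++⁺ʳ A (there (here refl)))

        a′∼pₖ : Adj G a′ pₖ
        a′∼pₖ = Adj-sym (Adj-from-4K₁-freeness
          (∈∉⇒≢ (L⊆P p₁∈L) r∉P) (L≢R p₁∈L pₖ∈R)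
          (λ p₁≡a′ → Unique-++-∷-disjoint A unique′ (head∈ route-A) (here p₁≡a′))
          (∉∈⇒≢ r∉P (R⊆P pₖ∈R)) (∉∈⇒≢ r∉P a′∈P) (∈∉⇒≢ (∈-++⁺ʳ B′ (there (last∈ route-Cs))) a′∉⋯)
          (λ p₁∼r → outside≁first r∉P (Adj-sym p₁∼r)) p₁≁pₖ p₁≁a′ (λ r∼pₖ → last≁outside r∉P (Adj-sym r∼pₖ)) r≁a′)

    attached-only-at-c : ∀ {r y} → r ∉ P → Adj G r y → y ∈ P → y ≡ c
    attached-only-at-c {y = y} r∉P r∼y y∈P with y ≟ᶠ c
    ... | yes y≡c = y≡c
    ... | no y≢c with precedes⊎follows P y∈P c∈P y≢c
    ...   | inj₁ (A , B , Cs , P≡) = ⊥-elim (¬attached A B Cs P≡ r∉P r₀∉ r∼y r₀∼c)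
    ...   | inj₂ (A , B , Cs , P≡) = ⊥-elim (¬attached A B Cs P≡ r₀∉ r∉P r₀∼c r∼y)

    r₀≁L : ∀ {x} → x ∈ L → ¬ Adj G r₀ x
    r₀≁L x∈L r₀∼x = L≢c x∈L (attached-only-at-c r₀∉ r₀∼x (L⊆P x∈L))

    route-pₖ⋯r₀ : Route pₖ (reverse (c ∷ R) ++ [ r₀ ]) r₀
    route-pₖ⋯r₀ = snoc (Route-reverse (link c∼ρ route-R)) (Adj-sym r₀∼c)

    ℓ≁pₖ : ¬ Adj G ℓ pₖ
    ℓ≁pₖ ℓ∼pₖ = ¬longer₁ (join route-L ℓ∼pₖ route-pₖ⋯r₀)
      (↭-trans (++⁺ˡ L (++⁺ʳ [ r₀ ] (↭-reverse (c ∷ R))))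
               (solve 4 (λ L c R r → L ⊕ ((c ⊕ R) ⊕ r) ⊜ r ⊕ (L ⊕ (c ⊕ R))) ↭-refl L [ c ] R [ r₀ ])) r₀∉

    ∼p₁-unless-∼pₖ : ∀ {w} → w ∈ L → w ≢ p₁ → ¬ Adj G w pₖ → Adj G w p₁
    ∼p₁-unless-∼pₖ w∈L w≢p₁ w≁pₖ = Adj-sym (Adj-from-4K₁-freeness
      (∈∉⇒≢ (R⊆P pₖ∈R) r₀∉) (λ pₖ≡p₁ → L≢R p₁∈L pₖ∈R (sym pₖ≡p₁)) (λ pₖ≡w → L≢R w∈L pₖ∈R (sym pₖ≡w))
      (∉∈⇒≢ r₀∉ (L⊆P p₁∈L)) (∉∈⇒≢ r₀∉ (L⊆P w∈L)) (λ p₁≡w → w≢p₁ (sym p₁≡w))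
      (last≁outside r₀∉) (λ pₖ∼p₁ → p₁≁pₖ (Adj-sym pₖ∼p₁)) (λ pₖ∼w → w≁pₖ (Adj-sym pₖ∼w))
      (outside≁first r₀∉) (r₀≁L w∈L))

    ℓ∼p₁ : ℓ ≢ p₁ → Adj G ℓ p₁
    ℓ∼p₁ ℓ≢p₁ = ∼p₁-unless-∼pₖ (last∈ route-L) ℓ≢p₁ ℓ≁pₖ

    split-L : ∀ {w} → w ∈ L → Σ (List V) λ X → Σ (List V) λ Y → L ≡ X ++ w ∷ Y ×
              Route p₁ (X ++ [ w ]) w × Route w (w ∷ Y) ℓ
    split-L w∈L with ∈-∃++ w∈L
    ... | X , Y , L≡ = X , Y , L≡ , split X (subst (λ Q → Route p₁ Q ℓ) L≡ route-L)

    -- With ℓ ∼ p₁, the rotation y … ℓ p₁ … w pₖ … c r₀ at the successor y of w is a longer path.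
    L≁pₖ : ∀ {w} → w ∈ L → ¬ Adj G w pₖ
    L≁pₖ {w} w∈L with split-L w∈L
    ... | X , Y , L≡ , route-X , route-w⋯ with Route-uncons route-w⋯
    ...   | inj₁ (_ , refl) = ℓ≁pₖ
    ...   | inj₂ (y , _ , route-Y) = λ w∼pₖ → ¬longer₁
             (join route-Y (ℓ∼p₁ ℓ≢p₁) (join route-X w∼pₖ route-pₖ⋯r₀))
             (subst (λ Z → _ ↭ r₀ ∷ (Z ++ c ∷ R)) (sym L≡)
               (↭-trans (++⁺ˡ Y (++⁺ˡ (X ++ [ w ]) (++⁺ʳ [ r₀ ] (↭-reverse (c ∷ R)))))
                  (solve 6 (λ Y X w c R r → Y ⊕ ((X ⊕ w) ⊕ ((c ⊕ R) ⊕ r)) ⊜ r ⊕ ((X ⊕ (w ⊕ Y)) ⊕ (c ⊕ R)))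
                     ↭-refl Y X [ w ] [ c ] R [ r₀ ]))) r₀∉
      where
        ℓ≢p₁ : ℓ ≢ p₁
        ℓ≢p₁ ℓ≡p₁ = Unique-++-∷-disjoint X (subst Unique L≡ (Unique-++ˡ L unique))
                      (head∈ route-X) (subst (_∈ Y) ℓ≡p₁ (last∈ route-Y))

    L∼p₁ : ∀ {w} → w ∈ L → w ≢ p₁ → Adj G w p₁
    L∼p₁ w∈L w≢p₁ = ∼p₁-unless-∼pₖ w∈L w≢p₁ (L≁pₖ w∈L)

    -- ℓ … y p₁ … u, where y is the successor of u.
    spanning-route-L : ∀ {u} → u ∈ L → u ≢ ℓ → Σ (List V) λ H → Route ℓ H u × H ↭ L
    spanning-route-L {u} u∈L u≢ℓ with split-L u∈L
    ... | X , Y , L≡ , route-X , route-u⋯ with Route-uncons route-u⋯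
    ...   | inj₁ (_ , u≡ℓ) = ⊥-elim (u≢ℓ u≡ℓ)
    ...   | inj₂ (y , _ , route-Y) =
      reverse Y ++ X ++ [ u ] , join (Route-reverse route-Y) (L∼p₁ y∈L y≢p₁) route-X ,
      subst (λ Z → reverse Y ++ X ++ [ u ] ↭ Z) (sym L≡)
        (↭-trans (++⁺ʳ (X ++ [ u ]) (↭-reverse Y)) (solve 3 (λ Y X u → Y ⊕ (X ⊕ u) ⊜ X ⊕ (u ⊕ Y)) ↭-refl Y X [ u ]))
      where
        y∈L : y ∈ L
        y∈L = subst (y ∈_) (sym L≡) (∈-++⁺ʳ X (there (head∈ route-Y)))
        y≢p₁ : y ≢ p₁
        y≢p₁ y≡p₁ = Unique-++-∷-disjoint X (subst Unique L≡ (Unique-++ˡ L unique))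
                      (head∈ route-X) (subst (_∈ Y) y≡p₁ (head∈ route-Y))

  module TwoSided (S : Setting) where
    open Split S public
    private module Mirror = Split (mirror S)

    spanning-route-R : ∀ {v} → v ∈ R → Σ (List V) λ H → Σ V λ t → Route v H t × H ↭ R
    spanning-route-R {v} v∈R with v ≟ᶠ ρ
    ... | yes refl = R , pₖ , route-R , ↭-refl
    ... | no v≢ρ with Mirror.spanning-route-L (reverse⁺ v∈R) v≢ρ
    ...   | H , route-H , H↭ = reverse H , ρ , Route-reverse route-H , ↭-trans (↭-reverse H) (↭-trans H↭ (↭-reverse R))

    ¬L∼R : ∀ {u v} → u ∈ L → v ∈ R → Adj G u v → u ≢ ℓ → ⊥
    ¬L∼R u∈L v∈R u∼v u≢ℓ with spanning-route-L u∈L u≢ℓ | spanning-route-R v∈R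
    ... | H , route-H , H↭L | H′ , _ , route-H′ , H′↭R =
      ¬longer₁ (link r₀∼c (link (Adj-sym ℓ∼c) (join route-H u∼v route-H′)))
        (↭-prep r₀ (↭-trans (↭-prep c (++⁺ H↭L H′↭R)) (↭-sym (shift c L R)))) r₀∉

    p₁≢ℓ : Adj G ℓ ρ → p₁ ≢ ℓ
    p₁≢ℓ ℓ∼ρ refl with Route-loop route-L (Unique-++ˡ L unique)
    ... | refl = ¬longer₁ (link r₀∼c (link (Adj-sym ℓ∼c) (link ℓ∼ρ route-R))) (↭-prep r₀ (↭-swap c ℓ ↭-refl)) r₀∉

    L-neighbours : Adj G ℓ ρ → ∀ {w y} → w ∈ L → w ≢ ℓ → Adj G w y → y ∈ L
    L-neighbours ℓ∼ρ {w} {y} w∈L w≢ℓ w∼y with y ∈? P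
    ... | no y∉P = ⊥-elim (L≢c w∈L (attached-only-at-c y∉P (Adj-sym w∼y) (L⊆P w∈L)))
    ... | yes y∈P with ∈-++⁻ L y∈P
    ...   | inj₁ y∈L = y∈L
    ...   | inj₂ (there y∈R) = ⊥-elim (¬L∼R w∈L y∈R w∼y w≢ℓ)
    ...   | inj₂ (here refl) with spanning-route-L w∈L w≢ℓ
    ...     | H , route-H , H↭L = ⊥-elim (¬longer₁
              (link r₀∼c (link (Adj-sym w∼y) (join (Route-reverse route-H) ℓ∼ρ route-R)))
              (↭-prep r₀ (↭-trans (↭-prep c (++⁺ʳ R (↭-trans (↭-reverse H) H↭L))) (↭-sym (shift c L R)))) r₀∉)

  module Dichotomy (S : Setting) where
    open TwoSided S
    private module Mirror = TwoSided (mirror S)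

    outside : List V
    outside = filter (λ v → ¬? (v ∈? P)) (allFin (n G))

    outside-unique : Unique outside
    outside-unique = Unique-filter⁺ _ (allFin⁺ (n G))

    pathCover : PathCover2 G
    pathCover = P , outside , Route⇒IsPath route-P unique ,
      (∈⇒length≥1 (∈-outside r₀∉) , outside-unique ,
       clique⇒Chain outside-unique (λ r∈ r′∈ → outside-adjacent (∉-outside r∈) (∉-outside r′∈))) ,
      (λ v v∈P v∈outside → ∉-outside v∈outside v∈P) , covered
      where
        ∈-outside : ∀ {v} → v ∉ P → v ∈ outside
        ∈-outside {v} = ∈-filter⁺ (λ v → ¬? (v ∈? P)) (∈-allFin v)
        ∉-outside : ∀ {v} → v ∈ outside → v ∉ P
        ∉-outside v∈ = proj₂ (∈-filter⁻ (λ v → ¬? (v ∈? P)) {xs = allFin (n G)} v∈)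
        covered : ∀ v → v ∈ P ⊎ v ∈ outside
        covered v with v ∈? P
        ... | yes v∈P = inj₁ v∈P
        ... | no v∉P = inj₂ (∈-outside v∉P)

    no-exit-from-outside : ∀ {a b} → a ∉ P → WalkIn G (Minus G c) a b → b ∉ P
    no-exit-from-outside = WalkIn-closed (_∉ P) λ u∉P _ w≢c u∼w w∈P → w≢c (attached-only-at-c u∉P u∼w w∈P)

    c-articulation : Articulation G c
    c-articulation = r₀ , p₁ , ∉∈⇒≢ r₀∉ c∈P , L≢c p₁∈L , λ r₀⇝p₁ → no-exit-from-outside r₀∉ r₀⇝p₁ (L⊆P p₁∈L)

    ¬CondA : (∀ {u v} → u ∈ L → v ∈ R → ¬ Adj G u v) → ¬ CondA G
    ¬CondA L≁R condA = ¬TwoComponents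
      (λ r₀⇝p₁ → no-exit-from-outside r₀∉ r₀⇝p₁ (L⊆P p₁∈L)) (λ r₀⇝pₖ → no-exit-from-outside r₀∉ r₀⇝pₖ (R⊆P pₖ∈R))
      (λ p₁⇝pₖ → L∉R (WalkIn-closed (_∈ L) L-closed p₁∈L p₁⇝pₖ) pₖ∈R)
      (∉∈⇒≢ r₀∉ c∈P) (L≢c p₁∈L) (R≢c pₖ∈R) (condA c c-articulation)
      where
        L-closed : ∀ {u w} → u ∈ L → u ≢ c → w ≢ c → Adj G u w → w ∈ L
        L-closed u∈L u≢c w≢c u∼w with _ ∈? P
        ... | no w∉P = ⊥-elim (u≢c (attached-only-at-c w∉P (Adj-sym u∼w) (L⊆P u∈L)))
        ... | yes w∈P with ∈-++⁻ L w∈P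
        ...   | inj₁ w∈L = w∈L
        ...   | inj₂ (here w≡c) = ⊥-elim (w≢c w≡c)
        ...   | inj₂ (there w∈R) = ⊥-elim (L≁R u∈L w∈R u∼w)

    ¬CondB : ∀ {u v} → u ∈ L → v ∈ R → Adj G u v → ¬ CondB G
    ¬CondB {u} {v} u∈L v∈R u∼v condB with u ≟ᶠ ℓ | v ≟ᶠ ρ
    ... | no u≢ℓ | _ = ¬L∼R u∈L v∈R u∼v u≢ℓ
    ... | yes _ | no v≢ρ = Mirror.¬L∼R (reverse⁺ v∈R) (reverse⁺ u∈L) (Adj-sym u∼v) v≢ρ
    ... | yes refl | yes refl = condB (ℓ , c , ρ , ℓ-articulation , c-articulation , ρ-articulation , ℓ∼c , c∼ρ , u∼v)
      where
        ℓ-articulation : Articulation G ℓ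
        ℓ-articulation = p₁ , r₀ , p₁≢ℓ u∼v , ∉∈⇒≢ r₀∉ (L⊆P (last∈ route-L)) , λ p₁⇝r₀ →
          r₀∉ (L⊆P (WalkIn-closed (_∈ L) (λ w∈L w≢ℓ _ → L-neighbours u∼v w∈L w≢ℓ) p₁∈L p₁⇝r₀))
        ρ-articulation : Articulation G ρ
        ρ-articulation = pₖ , r₀ , Mirror.p₁≢ℓ (Adj-sym u∼v) , ∉∈⇒≢ r₀∉ (R⊆P (head∈ route-R)) , λ pₖ⇝r₀ →
          r₀∉ (R⊆P (reverse⁻ (WalkIn-closed (_∈ reverse R)
            (λ w∈ w≢ρ _ → Mirror.L-neighbours (Adj-sym u∼v) w∈ w≢ρ) (reverse⁺ pₖ∈R) pₖ⇝r₀)))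

    ¬CondA⊎¬CondB : ¬ CondA G ⊎ ¬ CondB G
    ¬CondA⊎¬CondB with edge-between? L R
    ... | yes (_ , _ , u∈L , v∈R , u∼v) = inj₂ (¬CondB u∈L v∈R u∼v)
    ... | no ¬edge = inj₁ (¬CondA λ u∈L v∈R u∼v → ¬edge (_ , _ , u∈L , v∈R , u∼v))

  exit⇒Setting : ∀ {p₁ pₖ P c r₀} → Route p₁ P pₖ → Unique P → Longest P → c ∈ P → r₀ ∉ P → Adj G c r₀ → Setting
  exit⇒Setting route-P unique longest c∈P r₀∉P c∼r₀ with ∈-∃++ c∈P
  ... | L , R , refl with split L route-P
  ...   | route-Lc , route-cR with Route-unsnoc L route-Lc | Route-uncons route-cR
  ...     | inj₁ (_ , refl) | _ = ⊥-elim (Maximal.outside≁first route-P unique longest r₀∉P (Adj-sym c∼r₀))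
  ...     | inj₂ _ | inj₁ (_ , refl) = ⊥-elim (Maximal.last≁outside route-P unique longest r₀∉P c∼r₀)
  ...     | inj₂ (_ , route-L , ℓ∼c) | inj₂ (_ , c∼ρ , route-R) = record
    { L = L ; R = R ; route-L = route-L ; ℓ∼c = ℓ∼c ; c∼ρ = c∼ρ ; route-R = route-R
    ; unique = unique ; longest = longest ; r₀∉ = r₀∉P ; r₀∼c = Adj-sym c∼r₀ }

  HamiltonianPath⊎Setting : Connected G → HamiltonianPath G ⊎ Setting
  HamiltonianPath⊎Setting (n≥1 , connected) with longestPath (fromℕ< n≥1)
  ... | [] , (() , _) , _
  ... | p₁ ∷ ps , p-path@(_ , p-unique , p-chain) , p-longest with spanning⊎missing (p₁ ∷ ps)
  ...   | inj₁ p-spans = inj₁ (p₁ ∷ ps , p-path , p-spans)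
  ...   | inj₂ (r , r∉P) with WalkIn-exit (_∈ p₁ ∷ ps) (_∈? (p₁ ∷ ps)) (here refl) r∉P (connected p₁ r)
  ...     | c , r₀ , c∈P , r₀∉P , c∼r₀ =
    inj₂ (exit⇒Setting (proj₂ (Chain⇒Route p-chain)) p-unique p-longest c∈P r₀∉P c∼r₀)

theorem4 : (G : Graph) → Connected G → FourK1Free G →
    (HamiltonianPath G ⇔ (CondA G × CondB G)) × (¬ HamiltonianPath G → PathCover2 G)
theorem4 G connected 4K₁-free = mk⇔ HamiltonianPath⇒CondA×CondB CondA×CondB⇒HamiltonianPath , pathCover
  where
    open Necessity G
    open Sufficiency G 4K₁-free

    CondA×CondB⇒HamiltonianPath : CondA G × CondB G → HamiltonianPath G
    CondA×CondB⇒HamiltonianPath (condA , condB) with HamiltonianPath⊎Setting connected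
    ... | inj₁ hamiltonian = hamiltonian
    ... | inj₂ S with Dichotomy.¬CondA⊎¬CondB S
    ...   | inj₁ ¬condA = ⊥-elim (¬condA condA)
    ...   | inj₂ ¬condB = ⊥-elim (¬condB condB)

    pathCover : ¬ HamiltonianPath G → PathCover2 G
    pathCover ¬hamiltonian with HamiltonianPath⊎Setting connected
    ... | inj₁ hamiltonian = ⊥-elim (¬hamiltonian hamiltonian)
    ... | inj₂ S = Dichotomy.pathCover S
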